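{- Let $n\ge2$ and let $D$ be an arc diagram on $[n]$ in which every vertex is the right endpoint of at most one arc and every arc $(i,j)$ has length $j-i\in\{1,2\}$. Then $D=D_1\cdot D_2\cdots D_k$ for some $k\ge1$, where each $D_i$ is an interlacing diagram $L_m$ or an interconnecting diagram $C_m$ with $m\ge1$.
   Context: An arc diagram on $[n]$ is a set of arcs $(i,j)$ with $1\le i<j\le n$; its length is $n-1$. The interlacing diagram $L_m$ ($m\ge1$) is the arc diagram on $[m+1]$ with arcs $(i,i+2)$ for all $1\le i\le m-1$. The interconnecting diagram $C_m$ ($m\ge1$) is $L_m$ together with the arc $(1,2)$. The concatenation $D_1\cdot D_2$ of a diagram $D_1$ on $[p]$ and $D_2$ on $[q]$ is the diagram on $[p+q-1]$ whose arcs are those of $D_1$ together with the arcs of $D_2$ shifted by $p-1$ (so the last vertex of $D_1$ is identified with the first vertex of $D_2$). -}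

module Defs where

open import Data.Nat using (ℕ; zero; suc; _+_; _∸_; _≤_; _<_; _≤ᵇ_; _≡ᵇ_)
open import Data.Bool using (Bool; true; false; _∧_; _∨_)
open import Data.Product using (_×_; _,_)
open import Data.List.NonEmpty using (List⁺; _∷_)
open import Data.List using (List; []; _∷_)
open import Relation.Binary.PropositionalEquality using (_≡_)

-- An arc diagram: a number of vertices (vertices are 1 … size) together with
-- a decidable arc relation; arc i j ≡ true means (i , j) is an arc.
record Diagram : Set where
  constructor mkDiagram
  field
    size : ℕ
    arc  : ℕ → ℕ → Bool
open Diagram public

IsArcDiagramOn : ℕ → (ℕ → ℕ → Bool) → Set
IsArcDiagramOn n D = ∀ i j → D i j ≡ true → 1 ≤ i × i < j × j ≤ n

L : ℕ → Diagram
L m = mkDiagram (suc m) (λ i j → (1 ≤ᵇ i) ∧ (i ≤ᵇ m ∸ 1) ∧ (j ≡ᵇ i + 2))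

C : ℕ → Diagram
C m = mkDiagram (suc m) (λ i j → arc (L m) i j ∨ ((i ≡ᵇ 1) ∧ (j ≡ᵇ 2)))

_·_ : Diagram → Diagram → Diagram
D₁ · D₂ = mkDiagram (size D₁ + size D₂ ∸ 1)
  (λ i j → arc D₁ i j ∨ ((size D₁ ≤ᵇ i) ∧ arc D₂ (i ∸ (size D₁ ∸ 1)) (j ∸ (size D₁ ∸ 1))))

data Kind : Set where
  interlacing interconnecting : Kind

block : Kind → ℕ → Diagram
block interlacing    m = L m
block interconnecting m = C m

-- D₁ · D₂ · ⋯ · D_k (concatenation is associative; we bracket to the right).
concatFrom : Diagram → List Diagram → Diagram
concatFrom D [] = D
concatFrom D (E ∷ Es) = D · concatFrom E Es

concat⁺ : List⁺ Diagram → Diagram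
concat⁺ (D ∷ Ds) = concatFrom D Ds

-- Let M ≥ 1 be least such that D lacks the arc (M, M + 2); it exists because M = n - 1 qualifies.
-- Every arc leaving a vertex i ≤ M is then either (i, i + 2) with i < M or (1, 2), since right
-- endpoints are unique and (M, M + 2) is missing. So the arcs leaving [1, M] form L_M, or C_M
-- when (1, 2) ∈ D, no arc passes over vertex M + 1, and D = L_M · D′ or C_M · D′, where D′ is the
-- rest of D renumbered from M + 1: a smaller diagram with the same properties, unless n = M + 1.
module Submission where

open import Defs
open import Data.Nat using (ℕ; zero; suc; _+_; _∸_; _≤_; _<_; _≤ᵇ_; _≡ᵇ_; z≤n; s≤s)
open import Data.Nat.Properties
open import Data.Nat.Induction using (<-rec)
open import Data.Bool using (Bool; true; false; _∧_; _∨_; T)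
open import Data.Bool.Properties using (T-≡; T-∧; T-∨; ⇔→≡; ¬-not; not-¬; ∨-identityʳ; ∧-conicalˡ; ∧-conicalʳ)
open import Data.Product using (Σ; ∃-syntax; _×_; _,_; proj₁; proj₂)
open import Data.Product.Function.NonDependent.Propositional using (_×-⇔_)
open import Data.Sum using (_⊎_; inj₁; inj₂; map₂)
open import Data.Sum.Function.Propositional using (_⊎-⇔_)
open import Data.List using ([])
open import Data.List.NonEmpty using (List⁺; _∷_; toList) renaming (map to map⁺)
open import Data.List.Relation.Unary.All using (All; []; _∷_)
open import Data.Empty using (⊥; ⊥-elim)
open import Function.Base using (_∘_)
open import Function.Bundles using (_⇔_; mk⇔; Equivalence)
open import Function.Construct.Composition using (_⇔-∘_)
open import Function.Construct.Symmetry using (⇔-sym)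
open import Relation.Nullary using (¬_; yes; no)
open import Relation.Binary.PropositionalEquality using (_≡_; refl; sym; trans; cong; cong₂; subst; module ≡-Reasoning)

open Equivalence using (to; from)

Arcs : Set
Arcs = ℕ → ℕ → Bool

RightUnique : Arcs → Set
RightUnique D = ∀ i i′ j → D i j ≡ true → D i′ j ≡ true → i ≡ i′

ShortArcs : Arcs → Set
ShortArcs D = ∀ i j → D i j ≡ true → (j ∸ i ≡ 1) ⊎ (j ∸ i ≡ 2)

T-≤ᵇ : ∀ {m n} → T (m ≤ᵇ n) ⇔ m ≤ n
T-≤ᵇ = mk⇔ (≤ᵇ⇒≤ _ _) ≤⇒≤ᵇ

T-≡ᵇ : ∀ {m n} → T (m ≡ᵇ n) ⇔ m ≡ n
T-≡ᵇ = mk⇔ (≡ᵇ⇒≡ _ _) (≡⇒≡ᵇ _ _)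

≤ᵇ≡true⇔≤ : ∀ {m n} → (m ≤ᵇ n) ≡ true ⇔ m ≤ n
≤ᵇ≡true⇔≤ = T-≤ᵇ ⇔-∘ ⇔-sym T-≡

first-false : (P : ℕ → Bool) → ∀ k → P k ≡ false
  → ∃[ m ] m ≤ k × P m ≡ false × (∀ i → i < m → P i ≡ true)
first-false P zero Pk = 0 , z≤n , Pk , λ _ ()
first-false P (suc k) Pk with P 0 in P0
... | false = 0 , z≤n , P0 , λ _ ()
... | true with first-false (λ i → P (suc i)) k Pk
...   | m , m≤k , Pm , below = suc m , s≤s m≤k , Pm , λ where
          zero    _         → P0
          (suc i) (s≤s i<m) → below i i<m

m∸n≡o⇒m≡n+o : ∀ {m n o} → n ≤ m → m ∸ n ≡ o → m ≡ n + o
m∸n≡o⇒m≡n+o {n = n} n≤m m∸n≡o = trans (sym (m+[n∸m]≡n n≤m)) (cong (n +_) m∸n≡o)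

arc-false : ∀ {n i j} {A : Arcs} → IsArcDiagramOn n A → (i < j → j ≤ n → ⊥) → A i j ≡ false
arc-false {i = i} {j} wf impossible = ¬-not λ a → let _ , i<j , j≤n = wf i j a in impossible i<j j≤n

arc-beyond : ∀ {s i j} {A : Arcs} → IsArcDiagramOn (suc s) A → ¬ i ≤ s → A i j ≡ false
arc-beyond wf i≰s = arc-false wf λ i<j j≤1+s → i≰s (≤-pred (≤-trans i<j j≤1+s))

arcs-≡-from-prefix : ∀ {s} {A D : Arcs} → IsArcDiagramOn (suc s) A → IsArcDiagramOn (suc s) D
  → (∀ i j → i ≤ s → A i j ≡ D i j) → ∀ i j → A i j ≡ D i j
arcs-≡-from-prefix {s} wfA wfD prefix i j with i ≤? s
... | yes i≤s = prefix i j i≤s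
... | no  i≰s = trans (arc-beyond wfA i≰s) (sym (arc-beyond wfD i≰s))

-- Vertex s + 1 becomes 1; the guard drops the arcs leaving s, which would otherwise appear at vertex 0.
shift : ℕ → Arcs → Arcs
shift s D i j = (1 ≤ᵇ i) ∧ D (s + i) (s + j)

shift-isArcDiagramOn : ∀ {n} s {D : Arcs} → IsArcDiagramOn n D → IsArcDiagramOn (n ∸ s) (shift s D)
shift-isArcDiagramOn {n} s wf i j a with wf (s + i) (s + j) (∧-conicalʳ _ _ a)
... | _ , s+i<s+j , s+j≤n =
  to ≤ᵇ≡true⇔≤ (∧-conicalˡ _ _ a) , +-cancelˡ-< s i j s+i<s+j
  , m+n≤o⇒m≤o∸n j (subst (_≤ n) (+-comm s j) s+j≤n)

shift-rightUnique : ∀ s {D : Arcs} → RightUnique D → RightUnique (shift s D)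
shift-rightUnique s ru i i′ j a a′ = +-cancelˡ-≡ s i i′ (ru _ _ _ (∧-conicalʳ _ _ a) (∧-conicalʳ _ _ a′))

shift-shortArcs : ∀ s {D : Arcs} → ShortArcs D → ShortArcs (shift s D)
shift-shortArcs s sa i j a =
  subst (λ d → d ≡ 1 ⊎ d ≡ 2) ([m+n]∸[m+o]≡n∸o s j i) (sa _ _ (∧-conicalʳ _ _ a))

arc-at-shifted-target : ∀ {n s i} j {D : Arcs} → IsArcDiagramOn n D → s < i
  → D i (s + (j ∸ s)) ≡ D i j
arc-at-shifted-target {s = s} {i} j {D} wf s<i with s ≤? j
... | yes s≤j = cong (D i) (m+[n∸m]≡n s≤j)
... | no  s≰j = trans (arc-false wf λ i<s+0 _ → <-asym s<i (subst (i <_) s+[j∸s]≡s i<s+0))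
                      (sym (arc-false wf λ i<j _ → <-asym i<j (<-trans (≰⇒> s≰j) s<i)))
  where
  s+[j∸s]≡s : s + (j ∸ s) ≡ s
  s+[j∸s]≡s = trans (cong (s +_) (m≤n⇒m∸n≡0 (<⇒≤ (≰⇒> s≰j)))) (+-identityʳ s)

·-arcs : ∀ {n s} (B R : Diagram) {D : Arcs} → size B ≡ suc s
  → IsArcDiagramOn (suc s) (arc B) → IsArcDiagramOn n D
  → (∀ i j → i ≤ s → arc B i j ≡ D i j) → (∀ i j → arc R i j ≡ shift s D i j)
  → ∀ i j → arc (B · R) i j ≡ D i j
·-arcs {s = s} B R {D} size≡ wfB wfD left right i j rewrite size≡ with i ≤? s
... | yes i≤s = begin
  arc B i j ∨ ((suc s ≤ᵇ i) ∧ arc R (i ∸ s) (j ∸ s))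
    ≡⟨ cong₂ (λ b c → b ∨ (c ∧ arc R (i ∸ s) (j ∸ s))) (left i j i≤s) (¬-not (≤⇒≯ i≤s ∘ to ≤ᵇ≡true⇔≤)) ⟩
  D i j ∨ false
    ≡⟨ ∨-identityʳ (D i j) ⟩
  D i j ∎
  where open ≡-Reasoning
... | no i≰s = begin
  arc B i j ∨ ((suc s ≤ᵇ i) ∧ arc R (i ∸ s) (j ∸ s))
    ≡⟨ cong₂ (λ b c → b ∨ (c ∧ arc R (i ∸ s) (j ∸ s))) (arc-beyond wfB i≰s) (from ≤ᵇ≡true⇔≤ s<i) ⟩
  arc R (i ∸ s) (j ∸ s)
    ≡⟨ right (i ∸ s) (j ∸ s) ⟩
  (1 ≤ᵇ i ∸ s) ∧ D (s + (i ∸ s)) (s + (j ∸ s))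
    ≡⟨ cong₂ (λ c k → c ∧ D k (s + (j ∸ s))) (from ≤ᵇ≡true⇔≤ (m+n≤o⇒m≤o∸n 1 s<i)) (m+[n∸m]≡n (<⇒≤ s<i)) ⟩
  D i (s + (j ∸ s))
    ≡⟨ arc-at-shifted-target j wfD s<i ⟩
  D i j ∎
  where
  open ≡-Reasoning
  s<i : s < i
  s<i = ≰⇒> i≰s

InterlacingArc : ℕ → ℕ → ℕ → Set
InterlacingArc m i j = 1 ≤ i × i ≤ m × j ≡ i + 2

HeadArc : Bool → ℕ → ℕ → ℕ → Set
HeadArc c m i j = InterlacingArc m i j ⊎ (c ≡ true × i ≡ 1 × j ≡ 2)

kindOf : Bool → Kind
kindOf false = interlacing
kindOf true  = interconnecting

T-L : ∀ m i j → T (arc (L (suc m)) i j) ⇔ InterlacingArc m i j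
T-L m i j = (T-≤ᵇ ×-⇔ ((T-≤ᵇ ×-⇔ T-≡ᵇ) ⇔-∘ T-∧)) ⇔-∘ T-∧

T-C : ∀ m i j → T (arc (C (suc m)) i j) ⇔ (InterlacingArc m i j ⊎ i ≡ 1 × j ≡ 2)
T-C m i j = (T-L m i j ⊎-⇔ ((T-≡ᵇ ×-⇔ T-≡ᵇ) ⇔-∘ T-∧)) ⇔-∘ T-∨

block-arc⇔headArc : ∀ c m i j → arc (block (kindOf c) (suc m)) i j ≡ true ⇔ HeadArc c m i j
block-arc⇔headArc false m i j = mk⇔ (inj₁ ∘ to (T-L m i j)) from-head ⇔-∘ ⇔-sym T-≡
  where
  from-head : HeadArc false m i j → T (arc (L (suc m)) i j)
  from-head (inj₁ a) = from (T-L m i j) a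
  from-head (inj₂ (() , _))
block-arc⇔headArc true m i j = (mk⇔ (map₂ (refl ,_)) (map₂ proj₂) ⇔-∘ T-C m i j) ⇔-∘ ⇔-sym T-≡

headArc-bounds : ∀ {c m i j} → HeadArc c m i j → 1 ≤ i × i < j × j ≤ 2 + m
headArc-bounds {m = m} {i} (inj₁ (1≤i , i≤m , refl)) =
  1≤i , m<m+n i (s≤s z≤n) , subst (_≤ 2 + m) (+-comm 2 i) (+-monoʳ-≤ 2 i≤m)
headArc-bounds (inj₂ (_ , refl , refl)) = s≤s z≤n , s≤s (s≤s z≤n) , s≤s (s≤s z≤n)

block-isArcDiagramOn : ∀ c m → IsArcDiagramOn (2 + m) (arc (block (kindOf c) (suc m)))
block-isArcDiagramOn c m i j a = headArc-bounds (to (block-arc⇔headArc c m i j) a)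

size-block : ∀ k m → size (block k m) ≡ suc m
size-block interlacing    m = refl
size-block interconnecting m = refl

arc⇔headArc : ∀ {n m} {D : Arcs} → IsArcDiagramOn n D → RightUnique D → ShortArcs D
  → (∀ i → i < m → D (suc i) (suc i + 2) ≡ true) → D (suc m) (suc m + 2) ≡ false
  → ∀ i j → i ≤ suc m → D i j ≡ true ⇔ HeadArc (D 1 2) m i j
arc⇔headArc {m = m} {D} wf ru sa run cut i j i≤1+m = mk⇔ (to-head i j i≤1+m) (from-head i j)
  where
  from-head : ∀ i j → HeadArc (D 1 2) m i j → D i j ≡ true
  from-head (suc i) _ (inj₁ (_ , i<m , refl)) = run i i<m
  from-head _       _ (inj₂ (d₁₂ , refl , refl)) = d₁₂

  to-head : ∀ i j → i ≤ suc m → D i j ≡ true → HeadArc (D 1 2) m i j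
  to-head i j i≤1+m d with wf i j d | sa i j d
  ... | 1≤i , i<j , _ | inj₂ j∸i≡2 with m≤n⇒m<n∨m≡n i≤1+m
  ...   | inj₁ i<1+m = inj₁ (1≤i , ≤-pred i<1+m , m∸n≡o⇒m≡n+o (<⇒≤ i<j) j∸i≡2)
  ...   | inj₂ refl  = ⊥-elim (not-¬ (subst (λ k → D (suc m) k ≡ true) (m∸n≡o⇒m≡n+o (<⇒≤ i<j) j∸i≡2) d) cut)
  to-head (suc zero) j _ d | _ , i<j , _ | inj₁ j∸i≡1 =
    inj₂ (subst (λ k → D 1 k ≡ true) j≡2 d , refl , j≡2)
    where
    j≡2 : j ≡ 2
    j≡2 = m∸n≡o⇒m≡n+o (<⇒≤ i<j) j∸i≡1
  -- (i, i + 1) for i ≥ 2 would share its right endpoint with the arc (i - 1, i + 1).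
  to-head (suc (suc i)) j (s≤s i<m) d | _ , i<j , _ | inj₁ j∸i≡1 =
    ⊥-elim (1+n≢n (sym (ru (suc i) (suc (suc i)) j skip d)))
    where
    skip : D (suc i) j ≡ true
    skip = subst (λ k → D (suc i) k ≡ true)
                 (trans (cong suc (+-suc i 1)) (sym (m∸n≡o⇒m≡n+o (<⇒≤ i<j) j∸i≡1))) (run i i<m)

head-block-arcs : ∀ {n m} {D : Arcs} → IsArcDiagramOn n D → RightUnique D → ShortArcs D
  → (∀ i → i < m → D (suc i) (suc i + 2) ≡ true) → D (suc m) (suc m + 2) ≡ false
  → ∀ i j → i ≤ suc m → arc (block (kindOf (D 1 2)) (suc m)) i j ≡ D i j
head-block-arcs {m = m} {D} wf ru sa run cut i j i≤1+m =
  ⇔→≡ (⇔-sym (arc⇔headArc wf ru sa run cut i j i≤1+m) ⇔-∘ block-arc⇔headArc (D 1 2) m i j)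

blocks : List⁺ (Kind × ℕ) → Diagram
blocks bs = concat⁺ (map⁺ (λ b → block (proj₁ b) (proj₂ b)) bs)

Decomposition : ℕ → Arcs → Set
Decomposition n D = Σ (List⁺ (Kind × ℕ)) λ bs →
  All (λ b → 1 ≤ proj₂ b) (toList bs) × size (blocks bs) ≡ n × (∀ i j → arc (blocks bs) i j ≡ D i j)

block-decomposition : ∀ {m} c {D : Arcs} → IsArcDiagramOn (2 + m) D
  → (∀ i j → i ≤ suc m → arc (block (kindOf c) (suc m)) i j ≡ D i j) → Decomposition (2 + m) D
block-decomposition {m} c wf head =
  (kindOf c , suc m) ∷ [] , s≤s z≤n ∷ [] , size-block (kindOf c) (suc m)
  , arcs-≡-from-prefix (block-isArcDiagramOn c m) wf head

block∷-decomposition : ∀ {n m} c {D : Arcs} → suc m ≤ n → IsArcDiagramOn n D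
  → (∀ i j → i ≤ suc m → arc (block (kindOf c) (suc m)) i j ≡ D i j)
  → Decomposition (n ∸ suc m) (shift (suc m) D) → Decomposition n D
block∷-decomposition {n} {m} c 1+m≤n wf head (bs@(_ ∷ _) , all , size≡ , arcs≡) =
  (kindOf c , suc m) ∷ toList bs , s≤s z≤n ∷ all , size≡n
  , ·-arcs (block (kindOf c) (suc m)) (blocks bs) (size-block (kindOf c) (suc m))
           (block-isArcDiagramOn c m) wf head arcs≡
  where
  size≡n : size (block (kindOf c) (suc m)) + size (blocks bs) ∸ 1 ≡ n
  size≡n = begin
    size (block (kindOf c) (suc m)) + size (blocks bs) ∸ 1
      ≡⟨ cong₂ (λ a b → a + b ∸ 1) (size-block (kindOf c) (suc m)) size≡ ⟩
    suc m + (n ∸ suc m)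
      ≡⟨ m+[n∸m]≡n 1+m≤n ⟩
    n ∎
    where open ≡-Reasoning

Decomposable : ℕ → Set
Decomposable n = 2 ≤ n → (D : Arcs) → IsArcDiagramOn n D → RightUnique D → ShortArcs D → Decomposition n D

decompose : ∀ n → Decomposable n
decompose = <-rec Decomposable step
  where
  step : ∀ n → (∀ {n′} → n′ < n → Decomposable n′) → Decomposable n
  step (suc zero) _ (s≤s ())
  step (suc (suc k)) rec _ D wf ru sa
    with first-false (λ i → D (suc i) (suc i + 2)) k (arc-false wf λ _ → past-end)
    where
    past-end : ¬ suc k + 2 ≤ 2 + k
    past-end le = 1+n≰n (subst (λ x → suc x ≤ 2 + k) (+-comm k 2) le)
  ... | m , m≤k , cut , run with head-block-arcs wf ru sa run cut | m≤n⇒m<n∨m≡n m≤k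
  ...   | head | inj₂ refl = block-decomposition (D 1 2) wf head
  ...   | head | inj₁ m<k  = block∷-decomposition (D 1 2) (s≤s (≤-trans m≤k (n≤1+n k))) wf head
    (rec (s≤s (m∸n≤m (suc k) m)) (m+n≤o⇒m≤o∸n 2 (s≤s m<k)) (shift (suc m) D)
         (shift-isArcDiagramOn (suc m) wf) (shift-rightUnique (suc m) ru) (shift-shortArcs (suc m) sa))

lemma4p3 : (n : ℕ) → 2 ≤ n → (D : ℕ → ℕ → Bool) → IsArcDiagramOn n D
    → (∀ i i′ j → D i j ≡ true → D i′ j ≡ true → i ≡ i′)
    → (∀ i j → D i j ≡ true → (j ∸ i ≡ 1) ⊎ (j ∸ i ≡ 2))
    → Σ (List⁺ (Kind × ℕ)) (λ bs →
        All (λ b → 1 ≤ proj₂ b) (toList bs)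
        × size (concat⁺ (map⁺ (λ b → block (proj₁ b) (proj₂ b)) bs)) ≡ n
        × (∀ i j → arc (concat⁺ (map⁺ (λ b → block (proj₁ b) (proj₂ b)) bs)) i j ≡ D i j))
lemma4p3 = decompose
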